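{- Let $n$ be a positive integer. There exists a complete set of mutually orthogonal Latin squares of order $n$ if and only if $\bar{R}(n+1;n+1)=n^2+1$.
   Context: A complete set of mutually orthogonal Latin squares (MOLS) of order $n$ is a set of $n-1$ pairwise orthogonal Latin squares of order $n$; equivalently, an edge-coloring $f$ of $K_{n^2}$ with $n+1$ colors such that each color class $f^{ -1}(i)$ is isomorphic to $nK_n$ (disjoint union of $n$ copies of $K_n$). For a positive integer $N$, $[N]=\{1,\dots,N\}$. An edge-coloring of $K_N$ with $k$ colors is a map $f:\binom{[N]}{2}\to[k]$; $\alpha_i(f)$ is the independence number of the graph on $[N]$ whose edges are the pairs of color $i$. For positive integers $m_1,\dots,m_k$, $\bar{R}(m_1,\dots,m_k)$ is the least positive integer $N$ such that every edge-coloring $f$ of $K_N$ with $k$ colors has some $i\in[k]$ with $\alpha_i(f)\ge m_i$; $\bar{R}(m;k)$ denotes $\bar{R}(m,\dots,m)$ with $k$ arguments. -}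

module Defs where

open import Data.Nat using (ℕ; suc; _∸_; _*_; _≤_; _<_; _+_)
open import Data.Fin using (Fin)
open import Data.Product using (Σ; ∃; _×_; _,_)
open import Relation.Binary.PropositionalEquality using (_≡_; _≢_)
open import Relation.Nullary using (¬_)
open import Function.Definitions using (Bijective; Injective)

record LatinSquare (n : ℕ) : Set where
  field
    cell   : Fin n → Fin n → Fin n
    rowBij : ∀ i → Bijective _≡_ _≡_ (cell i)
    colBij : ∀ j → Bijective _≡_ _≡_ (λ i → cell i j)
open LatinSquare public

Orthogonal : ∀ {n} → LatinSquare n → LatinSquare n → Set
Orthogonal {n} L M =
  Bijective _≡_ _≡_ (λ (p : Fin n × Fin n) → let (i , j) = p in (cell L i j , cell M i j))

CompleteMOLS : ℕ → Set
CompleteMOLS n =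
  Σ (Fin (n ∸ 1) → LatinSquare n) λ L →
    ∀ a b → a ≢ b → Orthogonal (L a) (L b)

-- An edge-colouring of K_N with k colours: a symmetric map on ordered
-- pairs of vertices (values on the diagonal are irrelevant).
record EdgeColoring (N k : ℕ) : Set where
  field
    col : Fin N → Fin N → Fin k
    sym : ∀ x y → col x y ≡ col y x
open EdgeColoring public

αGE : ∀ {N k} → EdgeColoring N k → Fin k → ℕ → Set
αGE {N} f c m =
  Σ (Fin m → Fin N) λ g → Injective _≡_ _≡_ g ×
    (∀ a b → a ≢ b → col f (g a) (g b) ≢ c)

ArrowsDiag : ℕ → ℕ → ℕ → Set
ArrowsDiag N m k = (f : EdgeColoring N k) → ∃ λ c → αGE f c m

RbarDiagIs : ℕ → ℕ → ℕ → Set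
RbarDiagIs m k R =
  1 ≤ R × ArrowsDiag R m k × (∀ N → 1 ≤ N → N < R → ¬ ArrowsDiag N m k)

-- Summing Turán's bound |S|² ≤ a (2 e(S) + |S|), valid when S has no independent set of
-- size a + 1, over the n + 1 colour classes of a colouring of K_N gives N ≤ n² whenever
-- every colour class has independence number at most n; so R̄(n+1; n+1) ≤ n² + 1.
-- A complete set of MOLS of order n labels the n² cells by row, column and the symbol in
-- each square; two cells agree in at most one of these n + 1 labels, and colouring a pair
-- by that label makes every colour class a union of cliques of size n, so no colour has
-- an independent set of size n + 1.
-- Conversely, let every colour class of a colouring of K_{n²} have independence number at
-- most n. A weighted form of the same count bounds the non-neighbourhood of each vertex in
-- each colour, which together with the total degree n² − 1 makes every colour class
-- (n − 1)-regular; Turán's bound on a non-neighbourhood then leaves no room for an edge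
-- leaving the closed neighbourhood, so each colour class is n disjoint copies of K_n.
-- Classes of different colours meet in exactly one vertex, so rows, columns and the
-- remaining n − 1 colours form a complete set of MOLS.

module Submission where

open import Data.Bool as Bool using (Bool; true; false; _∧_; _∨_; not)
open import Data.Bool.Properties using (∧-comm; ∧-zeroʳ; ∧-identityʳ; ∨-zeroʳ; ¬-not)
open import Data.Empty using (⊥-elim)
open import Data.Fin using (Fin; zero; suc; _↑ˡ_; _↑ʳ_; splitAt; remQuot; combine; inject≤; finToFun; funToFin)
open import Data.Fin.Properties
  using (_≟_; any?; all?; ¬∀⟶∃¬; pigeonhole; <⇒≢; inject≤-injective; finToFun-funToFin; combine-remQuot;
         splitAt-↑ˡ; splitAt-↑ʳ; splitAt⁻¹-↑ˡ; splitAt⁻¹-↑ʳ)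
open import Data.List using (List; []; _∷_; allFin)
open import Data.List.Membership.Propositional using (_∈_)
open import Data.List.Membership.Propositional.Properties using (∈-allFin)
open import Data.List.Relation.Unary.Any using (here; there)
open import Data.Nat using (ℕ; zero; suc; _+_; _*_; _∸_; _≤_; _≰_; _<_; z≤n; s≤s; s≤s⁻¹)
open import Data.Nat.Properties hiding (_≟_; <⇒≢)
open import Algebra.Properties.Semiring.Sum +-*-semiring
  using (sum; sum-syntax; sum-cong-≗; ∑-distrib-+; ∑-comm; *-distribˡ-sum; *-distribʳ-sum)
open import Data.Nat.Tactic.RingSolver using (solve-∀)
open import Data.Product using (Σ; Σ-syntax; ∃; _×_; _,_; proj₁; proj₂)
open import Data.Sum using (_⊎_; inj₁; inj₂; [_,_]′)
open import Defs using (EdgeColoring; αGE; ArrowsDiag; RbarDiagIs; LatinSquare; Orthogonal; CompleteMOLS;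
                        cell; rowBij; colBij)
open import Function using (_∘_; flip)
open import Function.Bundles using (_⇔_; mk⇔)
open import Function.Definitions using (Injective; Bijective)
open import Relation.Binary.PropositionalEquality
open import Relation.Nullary using (Dec; yes; no; does; ¬_; ¬?; contradiction; _×-dec_; _→-dec_; _⊎-dec_)
open import Relation.Nullary.Decidable using (dec-true; dec-false; map′)

-- Finite sums

sum-const : ∀ n k → ∑[ i < n ] k ≡ n * k
sum-const zero    k = refl
sum-const (suc n) k = cong (k +_) (sum-const n k)

sum-mono-≤ : ∀ {n} {f g : Fin n → ℕ} → (∀ i → f i ≤ g i) → sum f ≤ sum g
sum-mono-≤ {zero}  f≤g = z≤n
sum-mono-≤ {suc n} f≤g = +-mono-≤ (f≤g zero) (sum-mono-≤ (f≤g ∘ suc))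

≤-sum : ∀ {n} (f : Fin n → ℕ) i → f i ≤ sum f
≤-sum f zero    = m≤m+n _ _
≤-sum f (suc i) = ≤-trans (≤-sum (f ∘ suc) i) (m≤n+m _ _)

sum-mono-≤-slack : ∀ {n} {f g : Fin n → ℕ} e i → (∀ j → f j ≤ g j) → f i + e ≤ g i →
                   sum f + e ≤ sum g
sum-mono-≤-slack {suc n} {f} {g} e zero f≤g fi+e≤gi = begin
  f zero + sum (f ∘ suc) + e   ≡⟨ +-assoc (f zero) _ e ⟩
  f zero + (sum (f ∘ suc) + e) ≡⟨ cong (f zero +_) (+-comm _ e) ⟩
  f zero + (e + sum (f ∘ suc)) ≡⟨ +-assoc (f zero) e _ ⟨
  f zero + e + sum (f ∘ suc)   ≤⟨ +-mono-≤ fi+e≤gi (sum-mono-≤ (f≤g ∘ suc)) ⟩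
  g zero + sum (g ∘ suc)       ∎
  where open ≤-Reasoning
sum-mono-≤-slack {suc n} {f} {g} e (suc i) f≤g fi+e≤gi = begin
  f zero + sum (f ∘ suc) + e   ≡⟨ +-assoc (f zero) _ e ⟩
  f zero + (sum (f ∘ suc) + e) ≤⟨ +-mono-≤ (f≤g zero) (sum-mono-≤-slack e i (f≤g ∘ suc) fi+e≤gi) ⟩
  g zero + sum (g ∘ suc)       ∎
  where open ≤-Reasoning

sum-≥-tight : ∀ {n} {f : Fin n → ℕ} b → (∀ i → b ≤ f i) → sum f ≡ n * b → ∀ i → f i ≡ b
sum-≥-tight {n} {f} b b≤f sum≡nb i = ≤-antisym fi≤b (b≤f i)
  where
  excess : n * b + (f i ∸ b) ≤ n * b + 0
  excess = begin
    n * b + (f i ∸ b)        ≡⟨ cong (_+ (f i ∸ b)) (sum-const n b) ⟨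
    ∑[ j < n ] b + (f i ∸ b) ≤⟨ sum-mono-≤-slack (f i ∸ b) i b≤f (≤-reflexive (m+[n∸m]≡n (b≤f i))) ⟩
    sum f                    ≡⟨ sum≡nb ⟩
    n * b                    ≡⟨ +-identityʳ (n * b) ⟨
    n * b + 0                ∎
    where open ≤-Reasoning
  fi≤b : f i ≤ b
  fi≤b = m∸n≡0⇒m≤n (n≤0⇒n≡0 (+-cancelˡ-≤ (n * b) _ _ excess))

-- Vertex sets

χ : Bool → ℕ
χ true  = 1
χ false = 0

χ-split : ∀ s t → χ s ≡ χ (s ∧ t) + χ (s ∧ not t)
χ-split true  true  = refl
χ-split true  false = refl
χ-split false _     = refl

χ-∧ : ∀ s t → χ s * χ t ≡ χ (s ∧ t)
χ-∧ true  t = +-identityʳ (χ t)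
χ-∧ false t = refl

VertexSet : ℕ → Set
VertexSet N = Fin N → Bool

module _ {N : ℕ} where

  ∣_∣ : VertexSet N → ℕ
  ∣ S ∣ = ∑[ x < N ] χ (S x)

  _⊆_ : VertexSet N → VertexSet N → Set
  T ⊆ S = ∀ x → T x ≡ true → S x ≡ true

  _∩_ _∖_ : VertexSet N → VertexSet N → VertexSet N
  (S ∩ T) x = S x ∧ T x
  (S ∖ T) x = S x ∧ not (T x)

  full : VertexSet N
  full _ = true

  ∁ : VertexSet N → VertexSet N
  ∁ S x = not (S x)

  ⁅_⁆ : Fin N → VertexSet N
  ⁅ x ⁆ y = does (y ≟ x)

  insert : Fin N → VertexSet N → VertexSet N
  insert x S y = does (y ≟ x) ∨ S y

  delete : Fin N → VertexSet N → VertexSet N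
  delete x S = S ∖ ⁅ x ⁆

  ∣∣-cong : ∀ {S T} → (∀ x → S x ≡ T x) → ∣ S ∣ ≡ ∣ T ∣
  ∣∣-cong S≗T = sum-cong-≗ (cong χ ∘ S≗T)

  ∣∣-partition : ∀ S T → ∣ S ∣ ≡ ∣ S ∩ T ∣ + ∣ S ∖ T ∣
  ∣∣-partition S T = trans (sum-cong-≗ (λ x → χ-split (S x) (T x))) (∑-distrib-+ (χ ∘ (S ∩ T)) (χ ∘ (S ∖ T)))

  ∣full∣ : ∣ full ∣ ≡ N
  ∣full∣ = trans (sum-const N 1) (*-identityʳ N)

  ∣∣+∣∁∣ : ∀ S → ∣ S ∣ + ∣ ∁ S ∣ ≡ N
  ∣∣+∣∁∣ S = trans (sym (∣∣-partition full S)) ∣full∣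

  ∣∣-empty : ∀ {S} → (∀ x → S x ≢ true) → ∣ S ∣ ≡ 0
  ∣∣-empty {S} S≡∅ = trans (∣∣-cong {T = λ _ → false} (λ x → ¬-not (S≡∅ x))) (trans (sum-const N 0) (*-zeroʳ N))

  ∈⇒1≤∣∣ : ∀ {S x} → S x ≡ true → 1 ≤ ∣ S ∣
  ∈⇒1≤∣∣ {S} {x} x∈S = ≤-trans (≤-reflexive (cong χ (sym x∈S))) (≤-sum (χ ∘ S) x)

  ∈-∩ : ∀ S T {x} → (S ∩ T) x ≡ true → S x ≡ true × T x ≡ true
  ∈-∩ S T {x} x∈S∩T with S x | T x
  ... | true | true = refl , refl

  ∩-∈ : ∀ S T {x} → S x ≡ true → T x ≡ true → (S ∩ T) x ≡ true
  ∩-∈ S T x∈S x∈T = cong₂ _∧_ x∈S x∈T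

  ∈-∖ : ∀ S T {x} → (S ∖ T) x ≡ true → S x ≡ true × T x ≡ false
  ∈-∖ S T {x} x∈S∖T with S x | T x
  ... | true | false = refl , refl

sum-⁅⁆ : ∀ {N} (x : Fin N) (g : Fin N → ℕ) → ∑[ y < N ] (χ (⁅ x ⁆ y) * g y) ≡ g x
sum-⁅⁆ {suc N} zero    g =
  trans (cong₂ _+_ (*-identityˡ (g zero)) (trans (sum-const N 0) (*-zeroʳ N))) (+-identityʳ _)
sum-⁅⁆ {suc N} (suc x) g = trans (sum-cong-≗ ⁅suc⁆) (sum-⁅⁆ x (g ∘ suc))
  where
  ⁅suc⁆ : ∀ y → χ (⁅ suc x ⁆ (suc y)) * g (suc y) ≡ χ (⁅ x ⁆ y) * g (suc y)
  ⁅suc⁆ y with y ≟ x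
  ... | yes _ = refl
  ... | no _  = refl

∣⁅⁆∣ : ∀ {N} (x : Fin N) → ∣ ⁅ x ⁆ ∣ ≡ 1
∣⁅⁆∣ x = trans (sum-cong-≗ (λ y → sym (*-identityʳ (χ (⁅ x ⁆ y))))) (sum-⁅⁆ x (λ _ → 1))

module _ {N : ℕ} where

  ∣insert∣ : ∀ (S : VertexSet N) x → S x ≡ false → ∣ insert x S ∣ ≡ suc ∣ S ∣
  ∣insert∣ S x x∉S = begin
    ∣ insert x S ∣
      ≡⟨ ∣∣-partition (insert x S) ⁅ x ⁆ ⟩
    ∣ insert x S ∩ ⁅ x ⁆ ∣ + ∣ insert x S ∖ ⁅ x ⁆ ∣
      ≡⟨ cong₂ _+_ (trans (∣∣-cong at-x) (∣⁅⁆∣ x)) (∣∣-cong off-x) ⟩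
    suc ∣ S ∣ ∎
    where
    open ≡-Reasoning
    at-x : ∀ y → (insert x S ∩ ⁅ x ⁆) y ≡ ⁅ x ⁆ y
    at-x y with y ≟ x
    ... | yes _ = refl
    ... | no _  = ∧-zeroʳ (S y)
    off-x : ∀ y → (insert x S ∖ ⁅ x ⁆) y ≡ S y
    off-x y with y ≟ x
    ... | yes refl = sym x∉S
    ... | no _     = ∧-identityʳ (S y)

  ∣delete∣ : ∀ (S : VertexSet N) x → S x ≡ true → ∣ S ∣ ≡ suc ∣ delete x S ∣
  ∣delete∣ S x x∈S = begin
    ∣ S ∣                                ≡⟨ ∣∣-partition S ⁅ x ⁆ ⟩
    ∣ S ∩ ⁅ x ⁆ ∣ + ∣ delete x S ∣       ≡⟨ cong (_+ ∣ delete x S ∣) (trans (∣∣-cong at-x) (∣⁅⁆∣ x)) ⟩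
    suc ∣ delete x S ∣                   ∎
    where
    open ≡-Reasoning
    at-x : ∀ y → (S ∩ ⁅ x ⁆) y ≡ ⁅ x ⁆ y
    at-x y with y ≟ x
    ... | yes refl = trans (∧-identityʳ (S y)) x∈S
    ... | no _     = ∧-zeroʳ (S y)

  ∉-insert : ∀ (S : VertexSet N) x y → insert x S y ≡ false → y ≢ x × S y ≡ false
  ∉-insert S x y y∉S+x with y ≟ x | S y
  ... | no y≢x | false = y≢x , refl

  ∈-delete : ∀ (S : VertexSet N) x y → delete x S y ≡ true → S y ≡ true × y ≢ x
  ∈-delete S x y y∈S-x with S y | y ≟ x
  ... | true | no y≢x = refl , y≢x

  ∈-insert : ∀ (S : VertexSet N) x y → insert x S y ≡ true → y ≡ x ⊎ S y ≡ true
  ∈-insert S x y y∈S+x with y ≟ x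
  ... | yes y≡x = inj₁ y≡x
  ... | no _    = inj₂ y∈S+x

  insert-∈ˡ : ∀ (S : VertexSet N) x → insert x S x ≡ true
  insert-∈ˡ S x = cong (_∨ S x) (dec-true (x ≟ x) refl)

  insert-∈ʳ : ∀ (S : VertexSet N) x y → S y ≡ true → insert x S y ≡ true
  insert-∈ʳ S x y y∈S = trans (cong (does (y ≟ x) ∨_) y∈S) (∨-zeroʳ _)

  nonempty : ∀ (S : VertexSet N) → 1 ≤ ∣ S ∣ → ∃ λ x → S x ≡ true
  nonempty S 1≤∣S∣ with any? (λ x → S x Bool.≟ true)
  ... | yes x∈S = x∈S
  ... | no  S≡∅ = contradiction (≤-trans 1≤∣S∣ (≤-reflexive (∣∣-empty (λ x x∈S → S≡∅ (x , x∈S))))) λ ()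

  enumerate : ∀ a (S : VertexSet N) → a ≤ ∣ S ∣ →
              Σ[ g ∈ (Fin a → Fin N) ] Injective _≡_ _≡_ g × (∀ i → S (g i) ≡ true)
  enumerate zero    S _ = (λ ()) , (λ { {()} }) , λ ()
  enumerate (suc a) S a<∣S∣ with nonempty S (≤-trans (s≤s z≤n) a<∣S∣)
  ... | x , x∈S = g , g-injective , g∈S
    where
    rest : Σ[ h ∈ (Fin a → Fin N) ] Injective _≡_ _≡_ h × (∀ i → delete x S (h i) ≡ true)
    rest = enumerate a (delete x S) (s≤s⁻¹ (≤-trans a<∣S∣ (≤-reflexive (∣delete∣ S x x∈S))))
    h : Fin a → Fin N
    h = proj₁ rest
    h∈S-x : ∀ i → S (h i) ≡ true × h i ≢ x
    h∈S-x i = ∈-delete S x (h i) (proj₂ (proj₂ rest) i)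
    g : Fin (suc a) → Fin N
    g zero    = x
    g (suc i) = h i
    g-injective : Injective _≡_ _≡_ g
    g-injective {zero}  {zero}  _    = refl
    g-injective {zero}  {suc j} x≡hj = contradiction (sym x≡hj) (proj₂ (h∈S-x j))
    g-injective {suc i} {zero}  hi≡x = contradiction hi≡x (proj₂ (h∈S-x i))
    g-injective {suc i} {suc j} same = cong suc (proj₁ (proj₂ rest) same)
    g∈S : ∀ i → S (g i) ≡ true
    g∈S zero    = x∈S
    g∈S (suc i) = proj₁ (h∈S-x i)

-- Graphs: Turán's bound and regular graphs

turán-step : ∀ {a s r e e′} → s ≤ a → r * r ≤ a * (e′ + r) → e′ + r + r ≤ e →
             (s + r) * (s + r) ≤ a * (e + (s + r))
turán-step {a} {s} {r} {e} {e′} s≤a ih e′+2r≤e = begin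
  (s + r) * (s + r)
    ≡⟨ square-expand s r ⟩
  s * s + (s * r + s * r) + r * r
    ≤⟨ +-mono-≤ (+-mono-≤ (*-monoˡ-≤ s s≤a) (+-mono-≤ (*-monoˡ-≤ r s≤a) (*-monoˡ-≤ r s≤a))) ih ⟩
  a * s + (a * r + a * r) + a * (e′ + r)
    ≡⟨ regroup a s r e′ ⟩
  a * (e′ + r + r + (s + r))
    ≤⟨ *-monoʳ-≤ a (+-monoˡ-≤ (s + r) e′+2r≤e) ⟩
  a * (e + (s + r)) ∎
  where
  open ≤-Reasoning
  square-expand : ∀ s r → (s + r) * (s + r) ≡ s * s + (s * r + s * r) + r * r
  square-expand = solve-∀
  regroup : ∀ a s r e′ → a * s + (a * r + a * r) + a * (e′ + r) ≡ a * (e′ + r + r + (s + r))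
  regroup = solve-∀

regular-arith : ∀ d e → (suc d * d) * (suc d * d) ≤ d * (e + suc d * d) → ¬ e + 1 ≤ (suc d * d) * d
regular-arith zero     e _   e+1≤0 = contradiction (≤-trans (m≤n+m 1 e) e+1≤0) λ ()
regular-arith (suc d′) e s²≤ e+1≤ = contradiction (+-cancelˡ-≤ (s * s) _ _ too-big) λ ()
  where
  d s : ℕ
  d = suc d′
  s = suc d * d
  too-big : s * s + d ≤ s * s + 0
  too-big = begin
    s * s + d                  ≤⟨ +-monoˡ-≤ d s²≤ ⟩
    d * (e + s) + d            ≡⟨ regroup d e s ⟩
    d * (e + 1) + d * s        ≤⟨ +-monoˡ-≤ (d * s) (*-monoʳ-≤ d e+1≤) ⟩
    d * (s * d) + d * s        ≡⟨ collapse d ⟩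
    s * s + 0                  ∎
    where
    open ≤-Reasoning
    regroup : ∀ d e s → d * (e + s) + d ≡ d * (e + 1) + d * s
    regroup = solve-∀
    collapse : ∀ d → d * ((suc d * d) * d) + d * (suc d * d) ≡ (suc d * d) * (suc d * d) + 0
    collapse = solve-∀

¬[true→false] : ∀ a b → ¬ (a ≡ true → b ≡ false) → a ≡ true × b ≡ true
¬[true→false] true  true  _     = refl , refl
¬[true→false] true  false ¬impl = contradiction (λ _ → refl) ¬impl
¬[true→false] false _     ¬impl = contradiction (λ ()) ¬impl

module Graph {N : ℕ} (adj : Fin N → Fin N → Bool)
                     (adj-sym : ∀ x y → adj x y ≡ adj y x)
                     (adj-irrefl : ∀ x → adj x x ≡ false) where

  Independent : VertexSet N → Set
  Independent J = ∀ x y → J x ≡ true → J y ≡ true → adj x y ≡ false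

  IndependenceBound : ℕ → VertexSet N → Set
  IndependenceBound a S = ∀ J → J ⊆ S → Independent J → ∣ J ∣ ≤ a

  Dominating : VertexSet N → VertexSet N → Set
  Dominating G S = ∀ x → S x ≡ true → G x ≡ true ⊎ ∃ λ y → G y ≡ true × adj x y ≡ true

  insert-independent : ∀ {I x} → Independent I → (∀ y → I y ≡ true → adj x y ≡ false) → Independent (insert x I)
  insert-independent {I} {x} I-indep x≁I y z y∈ z∈ with ∈-insert I x y y∈ | ∈-insert I x z z∈
  ... | inj₁ refl | inj₁ refl = adj-irrefl x
  ... | inj₁ refl | inj₂ z∈I  = x≁I z z∈I
  ... | inj₂ y∈I  | inj₁ refl = trans (adj-sym y x) (x≁I y y∈I)
  ... | inj₂ y∈I  | inj₂ z∈I  = I-indep y z y∈I z∈I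

  module Greedy (S : VertexSet N) where

    Extends : VertexSet N → Fin N → Set
    Extends I x = S x ≡ true × (∀ y → I y ≡ true → adj x y ≡ false)

    extends? : ∀ I x → Dec (Extends I x)
    extends? I x = (S x Bool.≟ true) ×-dec all? (λ y → (I y Bool.≟ true) →-dec (adj x y Bool.≟ false))

    greedy : VertexSet N → List (Fin N) → VertexSet N
    greedy I []       = I
    greedy I (x ∷ xs) with extends? I x
    ... | yes _ = greedy (insert x I) xs
    ... | no  _ = greedy I xs

    greedy-mono : ∀ I xs y → I y ≡ true → greedy I xs y ≡ true
    greedy-mono I []       y y∈I = y∈I
    greedy-mono I (x ∷ xs) y y∈I with extends? I x
    ... | yes _ = greedy-mono (insert x I) xs y (insert-∈ʳ I x y y∈I)
    ... | no  _ = greedy-mono I xs y y∈I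

    greedy-⊆ : ∀ I xs → I ⊆ S → greedy I xs ⊆ S
    greedy-⊆ I []       I⊆S = I⊆S
    greedy-⊆ I (x ∷ xs) I⊆S with extends? I x
    ... | no  _ = greedy-⊆ I xs I⊆S
    ... | yes (x∈S , _) = greedy-⊆ (insert x I) xs I+x⊆S
      where
      I+x⊆S : insert x I ⊆ S
      I+x⊆S y y∈I+x with ∈-insert I x y y∈I+x
      ... | inj₁ refl = x∈S
      ... | inj₂ y∈I  = I⊆S y y∈I

    greedy-independent : ∀ I xs → Independent I → Independent (greedy I xs)
    greedy-independent I []       I-indep = I-indep
    greedy-independent I (x ∷ xs) I-indep with extends? I x
    ... | no  _ = greedy-independent I xs I-indep
    ... | yes (_ , x≁I) = greedy-independent (insert x I) xs (insert-independent I-indep x≁I)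

    greedy-dominating : ∀ I xs x → x ∈ xs → S x ≡ true →
      greedy I xs x ≡ true ⊎ ∃ λ y → greedy I xs y ≡ true × adj x y ≡ true
    greedy-dominating I (x ∷ xs) x (here refl) x∈S with extends? I x
    ... | yes _ = inj₁ (greedy-mono (insert x I) xs x (insert-∈ˡ I x))
    ... | no ¬ext with ¬∀⟶∃¬ N _ (λ y → (I y Bool.≟ true) →-dec (adj x y Bool.≟ false)) (¬ext ∘ (x∈S ,_))
    ...   | y , x≁I-fails-at-y with ¬[true→false] (I y) (adj x y) x≁I-fails-at-y
    ...     | y∈I , x~y = inj₂ (y , greedy-mono I xs y y∈I , x~y)
    greedy-dominating I (x′ ∷ xs) x (there x∈xs) x∈S with extends? I x′
    ... | yes _ = greedy-dominating (insert x′ I) xs x x∈xs x∈S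
    ... | no  _ = greedy-dominating I xs x x∈xs x∈S

  maximal-independent : ∀ S → ∃ λ G → G ⊆ S × Independent G × Dominating G S
  maximal-independent S = G , greedy-⊆ ∅ (allFin N) (λ _ ()) , greedy-independent ∅ (allFin N) (λ _ _ ())
                            , λ x → greedy-dominating ∅ (allFin N) x (∈-allFin x)
    where
    open Greedy S
    ∅ : VertexSet N
    ∅ _ = false
    G = greedy ∅ (allFin N)

  neighboursIn : VertexSet N → Fin N → ℕ
  neighboursIn B x = ∣ B ∩ adj x ∣

  degree : Fin N → ℕ
  degree x = ∣ adj x ∣

  -- Ordered pairs: arcs S S is twice the number of edges inside S.
  arcs : VertexSet N → VertexSet N → ℕ
  arcs A B = ∑[ x < N ] (χ (A x) * neighboursIn B x)

  neighboursIn-partition : ∀ B T x → neighboursIn B x ≡ neighboursIn (B ∩ T) x + neighboursIn (B ∖ T) x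
  neighboursIn-partition B T x = trans (sum-cong-≗ split) (∑-distrib-+ {N} _ _)
    where
    split : ∀ y → χ (B y ∧ adj x y) ≡ χ ((B y ∧ T y) ∧ adj x y) + χ ((B y ∧ not (T y)) ∧ adj x y)
    split y with B y | T y
    ... | true  | true  = sym (+-identityʳ _)
    ... | true  | false = refl
    ... | false | _     = refl

  arcs-partitionˡ : ∀ A T B → arcs A B ≡ arcs (A ∩ T) B + arcs (A ∖ T) B
  arcs-partitionˡ A T B = trans (sum-cong-≗ split) (∑-distrib-+ {N} _ _)
    where
    split : ∀ x → χ (A x) * neighboursIn B x ≡ χ ((A ∩ T) x) * neighboursIn B x + χ ((A ∖ T) x) * neighboursIn B x
    split x = trans (cong (_* neighboursIn B x) (χ-split (A x) (T x))) (*-distribʳ-+ (neighboursIn B x) (χ ((A ∩ T) x)) _)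

  arcs-partitionʳ : ∀ A B T → arcs A B ≡ arcs A (B ∩ T) + arcs A (B ∖ T)
  arcs-partitionʳ A B T = trans (sum-cong-≗ split) (∑-distrib-+ {N} _ _)
    where
    split : ∀ x → χ (A x) * neighboursIn B x ≡ χ (A x) * neighboursIn (B ∩ T) x + χ (A x) * neighboursIn (B ∖ T) x
    split x = trans (cong (χ (A x) *_) (neighboursIn-partition B T x)) (*-distribˡ-+ (χ (A x)) (neighboursIn (B ∩ T) x) _)

  arcs-double-sum : ∀ A B → arcs A B ≡ ∑[ x < N ] ∑[ y < N ] χ (A x ∧ (B y ∧ adj x y))
  arcs-double-sum A B = sum-cong-≗ λ x →
    trans (*-distribˡ-sum {N} (χ (A x)) _) (sum-cong-≗ λ y → χ-∧ (A x) (B y ∧ adj x y))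

  arcs-sym : ∀ A B → arcs A B ≡ arcs B A
  arcs-sym A B = begin
    arcs A B
      ≡⟨ arcs-double-sum A B ⟩
    ∑[ x < N ] ∑[ y < N ] χ (A x ∧ (B y ∧ adj x y))
      ≡⟨ ∑-comm {N} {N} _ ⟩
    ∑[ y < N ] ∑[ x < N ] χ (A x ∧ (B y ∧ adj x y))
      ≡⟨ sum-cong-≗ (λ y → sum-cong-≗ λ x → cong χ (swap (A x) (B y) (adj-sym x y))) ⟩
    ∑[ y < N ] ∑[ x < N ] χ (B y ∧ (A x ∧ adj y x))
      ≡⟨ arcs-double-sum B A ⟨
    arcs B A ∎
    where
    open ≡-Reasoning
    swap : ∀ a b {c c′} → c ≡ c′ → a ∧ (b ∧ c) ≡ b ∧ (a ∧ c′)
    swap true  _ refl = refl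
    swap false b refl = sym (∧-zeroʳ b)

  ∣∣≤arcs : ∀ A B → (∀ x → A x ≡ true → ∃ λ y → B y ≡ true × adj x y ≡ true) → ∣ A ∣ ≤ arcs A B
  ∣∣≤arcs A B A→B = sum-mono-≤ pointwise
    where
    pointwise : ∀ x → χ (A x) ≤ χ (A x) * neighboursIn B x
    pointwise x with A x in x∈A
    ... | false = z≤n
    ... | true with A→B x x∈A
    ...   | y , y∈B , x~y = ≤-trans (∈⇒1≤∣∣ {S = B ∩ adj x} (∩-∈ B (adj x) y∈B x~y)) (≤-reflexive (sym (*-identityˡ _)))

  arcs-split : ∀ S T → arcs (S ∖ T) (S ∖ T) + arcs (S ∖ T) (S ∩ T) + arcs (S ∩ T) (S ∖ T) ≤ arcs S S
  arcs-split S T = begin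
    r + x + y          ≤⟨ m≤n+m _ g ⟩
    g + (r + x + y)    ≡⟨ regroup g y x r ⟩
    (g + y) + (x + r)  ≡⟨ cong₂ _+_ (arcs-partitionʳ (S ∩ T) S T) (arcs-partitionʳ (S ∖ T) S T) ⟨
    arcs (S ∩ T) S + arcs (S ∖ T) S ≡⟨ arcs-partitionˡ S T S ⟨
    arcs S S           ∎
    where
    open ≤-Reasoning
    r x y g : ℕ
    r = arcs (S ∖ T) (S ∖ T)
    x = arcs (S ∖ T) (S ∩ T)
    y = arcs (S ∩ T) (S ∖ T)
    g = arcs (S ∩ T) (S ∩ T)
    regroup : ∀ g y x r → g + (r + x + y) ≡ (g + y) + (x + r)
    regroup = solve-∀

  arcs-peel : ∀ S G → G ⊆ S → Dominating G S → arcs (S ∖ G) (S ∖ G) + ∣ S ∖ G ∣ + ∣ S ∖ G ∣ ≤ arcs S S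
  arcs-peel S G G⊆S G-dom = begin
    arcs (S ∖ G) (S ∖ G) + ∣ S ∖ G ∣ + ∣ S ∖ G ∣
      ≤⟨ +-mono-≤ (+-monoʳ-≤ (arcs (S ∖ G) (S ∖ G)) cross) (≤-trans cross (≤-reflexive (arcs-sym (S ∖ G) (S ∩ G)))) ⟩
    arcs (S ∖ G) (S ∖ G) + arcs (S ∖ G) (S ∩ G) + arcs (S ∩ G) (S ∖ G)
      ≤⟨ arcs-split S G ⟩
    arcs S S ∎
    where
    open ≤-Reasoning
    rest→core : ∀ y → (S ∖ G) y ≡ true → ∃ λ z → (S ∩ G) z ≡ true × adj y z ≡ true
    rest→core y y∈S∖G with ∈-∖ S G y∈S∖G
    ... | y∈S , y∉G with G-dom y y∈S
    ...   | inj₁ y∈G             = contradiction (trans (sym y∈G) y∉G) λ ()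
    ...   | inj₂ (z , z∈G , y~z) = z , ∩-∈ S G (G⊆S z z∈G) z∈G , y~z
    cross : ∣ S ∖ G ∣ ≤ arcs (S ∖ G) (S ∩ G)
    cross = ∣∣≤arcs (S ∖ G) (S ∩ G) rest→core

  -- Induct on S ∖ G for a maximal independent set G of S: G dominates S, so every vertex
  -- of S ∖ G has an arc into G and one back (arcs-peel).
  turán : ∀ a S → IndependenceBound a S → ∣ S ∣ * ∣ S ∣ ≤ a * (arcs S S + ∣ S ∣)
  turán a S = bounded ∣ S ∣ S ≤-refl
    where
    Bound : VertexSet N → Set
    Bound S = ∣ S ∣ * ∣ S ∣ ≤ a * (arcs S S + ∣ S ∣)

    bounded : ∀ fuel S → ∣ S ∣ ≤ fuel → IndependenceBound a S → Bound S
    bounded fuel S ∣S∣≤fuel α≤a with any? (λ x → S x Bool.≟ true)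
    ... | no S≡∅ = subst (λ s → s * s ≤ a * (arcs S S + s)) (sym (∣∣-empty (λ x x∈S → S≡∅ (x , x∈S)))) z≤n
    bounded zero S ∣S∣≤0 α≤a | yes (x , x∈S) = contradiction (≤-trans (∈⇒1≤∣∣ {S = S} x∈S) ∣S∣≤0) λ ()
    bounded (suc fuel) S ∣S∣≤1+fuel α≤a | yes (x , x∈S) with maximal-independent S
    ... | G , G⊆S , G-indep , G-dom =
      subst (λ s → s * s ≤ a * (arcs S S + s)) (sym (∣∣-partition S G))
        (turán-step (α≤a (S ∩ G) (λ y → proj₁ ∘ ∈-∩ S G) core-indep) ih (arcs-peel S G G⊆S G-dom))
      where
      core-indep : Independent (S ∩ G)
      core-indep y z y∈ z∈ = G-indep y z (proj₂ (∈-∩ S G y∈)) (proj₂ (∈-∩ S G z∈))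
      1≤∣core∣ : 1 ≤ ∣ S ∩ G ∣
      1≤∣core∣ with G-dom x x∈S
      ... | inj₁ x∈G            = ∈⇒1≤∣∣ {S = S ∩ G} (∩-∈ S G x∈S x∈G)
      ... | inj₂ (y , y∈G , _) = ∈⇒1≤∣∣ {S = S ∩ G} (∩-∈ S G (G⊆S y y∈G) y∈G)
      ∣rest∣≤fuel : ∣ S ∖ G ∣ ≤ fuel
      ∣rest∣≤fuel = s≤s⁻¹ (≤-trans (+-monoˡ-≤ ∣ S ∖ G ∣ 1≤∣core∣)
                                   (≤-trans (≤-reflexive (sym (∣∣-partition S G))) ∣S∣≤1+fuel))
      ih : Bound (S ∖ G)
      ih = bounded fuel (S ∖ G) ∣rest∣≤fuel (λ J J⊆rest → α≤a J (λ y → proj₁ ∘ ∈-∖ S G ∘ J⊆rest y))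

  arcs<∣∣*degree : ∀ d S {y z} → (∀ x → degree x ≡ d) → S z ≡ true → S y ≡ false → adj z y ≡ true →
                   arcs S S + 1 ≤ ∣ S ∣ * d
  arcs<∣∣*degree d S {y} {z} regular z∈S y∉S z~y = begin
    arcs S S + 1                 ≤⟨ sum-mono-≤-slack 1 z inside≤ inside<at-z ⟩
    ∑[ x < N ] (χ (S x) * d)     ≡⟨ *-distribʳ-sum {N} d (χ ∘ S) ⟨
    ∣ S ∣ * d                    ∎
    where
    open ≤-Reasoning
    degree-split : ∀ x → degree x ≡ neighboursIn S x + neighboursIn (∁ S) x
    degree-split = neighboursIn-partition full S
    inside≤ : ∀ x → χ (S x) * neighboursIn S x ≤ χ (S x) * d
    inside≤ x = *-monoʳ-≤ (χ (S x)) (≤-trans (m≤m+n _ _) (≤-reflexive (trans (sym (degree-split x)) (regular x))))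
    outside-z : 1 ≤ neighboursIn (∁ S) z
    outside-z = ∈⇒1≤∣∣ {S = (∁ S) ∩ adj z} (∩-∈ (∁ S) (adj z) (cong not y∉S) z~y)
    inside<at-z : χ (S z) * neighboursIn S z + 1 ≤ χ (S z) * d
    inside<at-z rewrite z∈S = begin
      neighboursIn S z + 0 + 1                    ≤⟨ +-monoʳ-≤ _ outside-z ⟩
      neighboursIn S z + 0 + neighboursIn (∁ S) z ≡⟨ cong (_+ neighboursIn (∁ S) z) (+-identityʳ _) ⟩
      neighboursIn S z + neighboursIn (∁ S) z     ≡⟨ degree-split z ⟨
      degree z                                    ≡⟨ regular z ⟩
      d                                           ≡⟨ +-identityʳ d ⟨
      d + 0                                       ∎

  -- Turán forces arcs S S ≥ ∣ S ∣ d, the most a d-regular graph allows, while an edge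
  -- leaving S would cost one arc.
  no-edge-leaves : ∀ d S → (∀ x → degree x ≡ d) → ∣ S ∣ ≡ suc d * d → IndependenceBound d S →
                   ∀ {y z} → S z ≡ true → adj z y ≡ true → S y ≡ true
  no-edge-leaves d S regular ∣S∣≡ αS {y} {z} z∈S z~y with S y in y∈S
  ... | true  = refl
  ... | false = ⊥-elim (regular-arith d (arcs S S)
                  (subst (λ s → s * s ≤ d * (arcs S S + s)) ∣S∣≡ (turán d S αS))
                  (subst (λ s → arcs S S + 1 ≤ s * d) ∣S∣≡ (arcs<∣∣*degree d S regular z∈S y∈S z~y)))

  closedNeighbourhood : Fin N → VertexSet N
  closedNeighbourhood x = insert x (adj x)

  nonNeighbours : Fin N → VertexSet N
  nonNeighbours x = ∁ (closedNeighbourhood x)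

  ∣closedNeighbourhood∣ : ∀ x → ∣ closedNeighbourhood x ∣ ≡ suc (degree x)
  ∣closedNeighbourhood∣ x = ∣insert∣ (adj x) x (adj-irrefl x)

  ∈-nonNeighbours : ∀ {x y} → nonNeighbours x y ≡ true → y ≢ x × adj x y ≡ false
  ∈-nonNeighbours {x} {y} y∈far with insert x (adj x) y in y∈N
  ... | false = ∉-insert (adj x) x y y∈N

  nonNeighbours-bound : ∀ a → IndependenceBound (suc a) full → ∀ x → IndependenceBound a (nonNeighbours x)
  nonNeighbours-bound a α≤1+a x J J⊆far J-indep = s≤s⁻¹ (begin
    suc ∣ J ∣         ≡⟨ ∣insert∣ J x x∉J ⟨
    ∣ insert x J ∣    ≤⟨ α≤1+a (insert x J) (λ _ _ → refl) (insert-independent J-indep x≁J) ⟩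
    suc a             ∎)
    where
    open ≤-Reasoning
    x≁J : ∀ y → J y ≡ true → adj x y ≡ false
    x≁J y = proj₂ ∘ ∈-nonNeighbours ∘ J⊆far y
    x∉J : J x ≡ false
    x∉J with J x in x∈J
    ... | true  = contradiction refl (proj₁ (∈-nonNeighbours (J⊆far x x∈J)))
    ... | false = refl

-- Colour classes of an edge colouring

square-≤⇒≤ : ∀ M b → M * M ≤ b * M → M ≤ b
square-≤⇒≤ zero    b _     = z≤n
square-≤⇒≤ (suc M) b M²≤bM = *-cancelʳ-≤ (suc M) b (suc M) M²≤bM

uniform-arith : ∀ a M T → (a + 1) * (M * M) ≤ a * T → T + M ≡ M * M + (a + 1) * M → M ≤ a * a
uniform-arith a M T turán-sum T+M≡ = square-≤⇒≤ M (a * a) (+-cancelʳ-≤ X (M * M) (a * a * M) (begin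
  M * M + X                      ≡⟨ lhs a M ⟩
  (a + 1) * (M * M) + a * M      ≤⟨ +-monoˡ-≤ (a * M) turán-sum ⟩
  a * T + a * M                  ≡⟨ *-distribˡ-+ a T M ⟨
  a * (T + M)                    ≡⟨ cong (a *_) T+M≡ ⟩
  a * (M * M + (a + 1) * M)      ≡⟨ rhs a M ⟩
  a * a * M + X                  ∎))
  where
  open ≤-Reasoning
  X : ℕ
  X = a * (M * M) + a * M
  lhs : ∀ a M → M * M + (a * (M * M) + a * M) ≡ (a + 1) * (M * M) + a * M
  lhs = solve-∀
  rhs : ∀ a M → a * (M * M + (a + 1) * M) ≡ a * a * M + (a * (M * M) + a * M)
  rhs = solve-∀

mixed-arith : ∀ a M T → (suc a + 1) * (a * (M * M)) + M * M ≤ suc a * a * T →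
              T + M ≡ M * M + (suc a + 1) * M → M ≤ suc a * a
mixed-arith a M T weighted-sum T+M≡ =
  square-≤⇒≤ M (suc a * a) (*-cancelˡ-≤ (suc a) (+-cancelʳ-≤ X (suc a * (M * M)) _ (begin
    suc a * (M * M) + X                                  ≡⟨ lhs a M ⟩
    (suc a + 1) * (a * (M * M)) + M * M + suc a * a * M  ≤⟨ +-monoˡ-≤ (suc a * a * M) weighted-sum ⟩
    suc a * a * T + suc a * a * M                        ≡⟨ *-distribˡ-+ (suc a * a) T M ⟨
    suc a * a * (T + M)                                  ≡⟨ cong (suc a * a *_) T+M≡ ⟩
    suc a * a * (M * M + (suc a + 1) * M)                ≡⟨ rhs a M ⟩
    suc a * (suc a * a * M) + X                          ∎)))
  where
  open ≤-Reasoning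
  X : ℕ
  X = suc a * a * (M * M) + suc a * a * M
  lhs : ∀ a M → suc a * (M * M) + (suc a * a * (M * M) + suc a * a * M) ≡
                (suc a + 1) * (a * (M * M)) + M * M + suc a * a * M
  lhs = solve-∀
  rhs : ∀ a M → suc a * a * (M * M + (suc a + 1) * M) ≡
                suc a * (suc a * a * M) + (suc a * a * (M * M) + suc a * a * M)
  rhs = solve-∀

module Colouring {N k : ℕ} (f : EdgeColoring N k) where

  open EdgeColoring f using (col)

  -- col x x is junk; the first conjunct keeps loops out of every colour class.
  colourClass : Fin k → Fin N → Fin N → Bool
  colourClass c x y = not (⁅ x ⁆ y) ∧ ⁅ col x y ⁆ c

  colourClass-sym : ∀ c x y → colourClass c x y ≡ colourClass c y x
  colourClass-sym c x y = by-cases (x ≟ y)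
    where
    by-cases : Dec (x ≡ y) → colourClass c x y ≡ colourClass c y x
    by-cases (yes refl) = refl
    by-cases (no x≢y)   = cong₂ (λ u v → not u ∧ does (c ≟ v))
                                (trans (dec-false (y ≟ x) (x≢y ∘ sym)) (sym (dec-false (x ≟ y) x≢y)))
                                (EdgeColoring.sym f x y)

  colourClass-irrefl : ∀ c x → colourClass c x x ≡ false
  colourClass-irrefl c x = cong (λ b → not b ∧ ⁅ col x x ⁆ c) (dec-true (x ≟ x) refl)

  colourClass-intro : ∀ {c x y} → x ≢ y → col x y ≡ c → colourClass c x y ≡ true
  colourClass-intro {c} {x} {y} x≢y refl =
    cong₂ (λ u v → not u ∧ v) (dec-false (y ≟ x) (x≢y ∘ sym)) (dec-true (col x y ≟ col x y) refl)

  colourClass-elim : ∀ {c x y} → colourClass c x y ≡ true → x ≢ y × col x y ≡ c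
  colourClass-elim {c} {x} {y} x~y with y ≟ x | c ≟ col x y
  ... | no y≢x | yes c≡col = y≢x ∘ sym , sym c≡col

  colourClass-other : ∀ {c x y} → x ≢ y → colourClass c x y ≡ false → col x y ≢ c
  colourClass-other x≢y x≁y col≡c = contradiction (trans (sym (colourClass-intro x≢y col≡c)) x≁y) λ ()

  open module ColourGraph (c : Fin k) = Graph (colourClass c) (colourClass-sym c) (colourClass-irrefl c)
    public

  independent⇒αGE : ∀ c a J → Independent c J → a ≤ ∣ J ∣ → αGE f c a
  independent⇒αGE c a J J-indep a≤∣J∣ with enumerate a J a≤∣J∣
  ... | g , g-injective , g∈J = g , g-injective , λ i j i≢j →
    colourClass-other (i≢j ∘ g-injective) (J-indep (g i) (g j) (g∈J i) (g∈J j))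

  independence-bound : ∀ c a → ¬ αGE f c (suc a) → ∀ S → IndependenceBound c a S
  independence-bound c a ¬α S J _ J-indep =
    ≮⇒≥ (¬α ∘ independent⇒αGE c (suc a) J J-indep)

  ∑-colourClass : ∀ b x y → ∑[ c < k ] χ (b ∧ colourClass c x y) ≡ χ (b ∧ not (⁅ x ⁆ y))
  ∑-colourClass false x y = trans (sum-const k 0) (*-zeroʳ k)
  ∑-colourClass true  x y with ⁅ x ⁆ y
  ... | true  = trans (sum-const k 0) (*-zeroʳ k)
  ... | false = ∣⁅⁆∣ (col x y)

  ∑-neighboursIn : ∀ S x → ∑[ c < k ] neighboursIn c S x + χ (S x) ≡ ∣ S ∣
  ∑-neighboursIn S x = begin
    ∑[ c < k ] ∑[ y < N ] χ (S y ∧ colourClass c x y) + χ (S x)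
      ≡⟨ cong (_+ χ (S x)) (∑-comm {k} {N} _) ⟩
    ∑[ y < N ] ∑[ c < k ] χ (S y ∧ colourClass c x y) + χ (S x)
      ≡⟨ cong₂ _+_ (sum-cong-≗ (λ y → ∑-colourClass (S y) x y)) at-x ⟩
    ∣ S ∖ ⁅ x ⁆ ∣ + ∣ S ∩ ⁅ x ⁆ ∣
      ≡⟨ +-comm ∣ S ∖ ⁅ x ⁆ ∣ _ ⟩
    ∣ S ∩ ⁅ x ⁆ ∣ + ∣ S ∖ ⁅ x ⁆ ∣
      ≡⟨ ∣∣-partition S ⁅ x ⁆ ⟨
    ∣ S ∣ ∎
    where
    open ≡-Reasoning
    at-x : χ (S x) ≡ ∣ S ∩ ⁅ x ⁆ ∣
    at-x = trans (sym (sum-⁅⁆ x (χ ∘ S)))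
                 (sum-cong-≗ λ y → trans (χ-∧ (⁅ x ⁆ y) (S y)) (cong χ (∧-comm (⁅ x ⁆ y) (S y))))

  ∑-arcs : ∀ S → ∑[ c < k ] arcs c S S + ∣ S ∣ ≡ ∣ S ∣ * ∣ S ∣
  ∑-arcs S = begin
    ∑[ c < k ] ∑[ x < N ] (χ (S x) * neighboursIn c S x) + ∣ S ∣
      ≡⟨ cong (_+ ∣ S ∣) (∑-comm {k} {N} _) ⟩
    ∑[ x < N ] ∑[ c < k ] (χ (S x) * neighboursIn c S x) + ∣ S ∣
      ≡⟨ cong (_+ ∣ S ∣) (sum-cong-≗ λ x → *-distribˡ-sum {k} (χ (S x)) _) ⟨
    ∑[ x < N ] (χ (S x) * ∑[ c < k ] neighboursIn c S x) + ∣ S ∣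
      ≡⟨ ∑-distrib-+ {N} _ _ ⟨
    ∑[ x < N ] (χ (S x) * ∑[ c < k ] neighboursIn c S x + χ (S x))
      ≡⟨ sum-cong-≗ (λ x → idempotent (S x) _) ⟩
    ∑[ x < N ] (χ (S x) * (∑[ c < k ] neighboursIn c S x + χ (S x)))
      ≡⟨ sum-cong-≗ (λ x → cong (χ (S x) *_) (∑-neighboursIn S x)) ⟩
    ∑[ x < N ] (χ (S x) * ∣ S ∣)
      ≡⟨ *-distribʳ-sum {N} ∣ S ∣ (χ ∘ S) ⟨
    ∣ S ∣ * ∣ S ∣ ∎
    where
    open ≡-Reasoning
    idempotent : ∀ s n → χ s * n + χ s ≡ χ s * (n + χ s)
    idempotent true  n = trans (cong (_+ 1) (+-identityʳ n)) (sym (+-identityʳ (n + 1)))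
    idempotent false n = refl

  ∑-arcs+∣∣ : ∀ S → ∑[ c < k ] (arcs c S S + ∣ S ∣) + ∣ S ∣ ≡ ∣ S ∣ * ∣ S ∣ + k * ∣ S ∣
  ∑-arcs+∣∣ S = begin
    ∑[ c < k ] (arcs c S S + M) + M       ≡⟨ cong (_+ M) (∑-distrib-+ {k} (λ c → arcs c S S) (λ _ → M)) ⟩
    ∑[ c < k ] arcs c S S + ∑[ c < k ] M + M ≡⟨ cong (λ t → ∑[ c < k ] arcs c S S + t + M) (sum-const k M) ⟩
    ∑[ c < k ] arcs c S S + k * M + M     ≡⟨ swap (∑[ c < k ] arcs c S S) (k * M) M ⟩
    ∑[ c < k ] arcs c S S + M + k * M     ≡⟨ cong (_+ k * M) (∑-arcs S) ⟩
    M * M + k * M                         ∎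
    where
    open ≡-Reasoning
    M : ℕ
    M = ∣ S ∣
    swap : ∀ a b c → a + b + c ≡ a + c + b
    swap = solve-∀

  uniform-bound : ∀ a → k ≡ a + 1 → ∀ S → (∀ c → IndependenceBound c a S) → ∣ S ∣ ≤ a * a
  uniform-bound a refl S α≤a = uniform-arith a M _ turán-sum (∑-arcs+∣∣ S)
    where
    open ≤-Reasoning
    M : ℕ
    M = ∣ S ∣
    turán-sum : (a + 1) * (M * M) ≤ a * ∑[ c < k ] (arcs c S S + M)
    turán-sum = begin
      (a + 1) * (M * M)                     ≡⟨ sum-const k (M * M) ⟨
      ∑[ c < k ] (M * M)                    ≤⟨ sum-mono-≤ (λ c → turán c a S (α≤a c)) ⟩
      ∑[ c < k ] (a * (arcs c S S + M))     ≡⟨ *-distribˡ-sum {k} a (λ c → arcs c S S + M) ⟨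
      a * ∑[ c < k ] (arcs c S S + M)       ∎

  mixed-bound : ∀ a → k ≡ suc a + 1 → ∀ c S → IndependenceBound c a S →
                (∀ d → d ≢ c → IndependenceBound d (suc a) S) → ∣ S ∣ ≤ suc a * a
  mixed-bound a refl c S α≤a α≤1+a = mixed-arith a M _ weighted-sum (∑-arcs+∣∣ S)
    where
    open ≤-Reasoning
    M : ℕ
    M = ∣ S ∣
    at-c : a * (M * M) + M * M ≤ suc a * a * (arcs c S S + M)
    at-c = begin
      a * (M * M) + M * M                ≡⟨ +-comm (a * (M * M)) (M * M) ⟩
      suc a * (M * M)                    ≤⟨ *-monoʳ-≤ (suc a) (turán c a S α≤a) ⟩
      suc a * (a * (arcs c S S + M))     ≡⟨ *-assoc (suc a) a _ ⟨
      suc a * a * (arcs c S S + M)       ∎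
    elsewhere : ∀ d → a * (M * M) ≤ suc a * a * (arcs d S S + M)
    elsewhere d with d ≟ c
    ... | yes refl = ≤-trans (m≤m+n _ _) at-c
    ... | no d≢c   = begin
      a * (M * M)                        ≤⟨ *-monoʳ-≤ a (turán d (suc a) S (α≤1+a d d≢c)) ⟩
      a * (suc a * (arcs d S S + M))     ≡⟨ *-assoc a (suc a) _ ⟨
      a * suc a * (arcs d S S + M)       ≡⟨ cong (_* (arcs d S S + M)) (*-comm a (suc a)) ⟩
      suc a * a * (arcs d S S + M)       ∎
    weighted-sum : (suc a + 1) * (a * (M * M)) + M * M ≤ suc a * a * ∑[ d < k ] (arcs d S S + M)
    weighted-sum = begin
      (suc a + 1) * (a * (M * M)) + M * M         ≡⟨ cong (_+ M * M) (sum-const k (a * (M * M))) ⟨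
      ∑[ d < k ] (a * (M * M)) + M * M            ≤⟨ sum-mono-≤-slack (M * M) c elsewhere at-c ⟩
      ∑[ d < k ] (suc a * a * (arcs d S S + M))   ≡⟨ *-distribˡ-sum {k} (suc a * a) (λ d → arcs d S S + M) ⟨
      suc a * a * ∑[ d < k ] (arcs d S S + M)     ∎

-- Exhaustive search

∃-function? : ∀ {m n} {P : (Fin m → Fin n) → Set} → (∀ {g h} → g ≗ h → P g → P h) →
              (∀ g → Dec (P g)) → Dec (∃ P)
∃-function? resp P? = map′ (λ { (i , p) → finToFun i , p })
                           (λ { (g , p) → funToFin g , resp (sym ∘ finToFun-funToFin g) p })
                           (any? (P? ∘ finToFun))

∃-function₂? : ∀ {l m n} {P : (Fin l → Fin m → Fin n) → Set} →
               (∀ {g h} → (∀ x y → g x y ≡ h x y) → P g → P h) → (∀ g → Dec (P g)) → Dec (∃ P)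
∃-function₂? resp P? =
  map′ (λ { (h , p) → (finToFun ∘ h) , p })
       (λ { (g , p) → (funToFin ∘ g) , resp (λ x → sym ∘ finToFun-funToFin (g x)) p })
       (∃-function? (λ h≗h′ → resp (λ x y → cong (λ i → finToFun i y) (h≗h′ x))) (P? ∘ (finToFun ∘_)))

module _ {N k : ℕ} where

  injective? : ∀ {a} (g : Fin a → Fin N) → Dec (Injective _≡_ _≡_ g)
  injective? g = map′ (λ inj {i} {j} → inj i j) (λ inj i j → inj {i} {j})
                      (all? λ i → all? λ j → (g i ≟ g j) →-dec (i ≟ j))

  αGE? : ∀ (f : EdgeColoring N k) c a → Dec (αGE f c a)
  αGE? f c a = ∃-function? transport (λ g → injective? g ×-dec
                 all? λ i → all? λ j → ¬? (i ≟ j) →-dec ¬? (EdgeColoring.col f (g i) (g j) ≟ c))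
    where
    Witness : (Fin a → Fin N) → Set
    Witness g = Injective _≡_ _≡_ g × (∀ i j → i ≢ j → EdgeColoring.col f (g i) (g j) ≢ c)
    transport : ∀ {g h} → g ≗ h → Witness g → Witness h
    transport g≗h (g-inj , g-indep) =
      (λ {i} {j} hi≡hj → g-inj (trans (g≗h i) (trans hi≡hj (sym (g≗h j))))) ,
      λ i j i≢j → g-indep i j i≢j ∘ trans (cong₂ (EdgeColoring.col f) (g≗h i) (g≗h j))

  -- Exhaustive search over all colourings turns ¬ ∀ f ∃ c into ∃ f ∀ c ¬.
  bad-colouring : ∀ a → ¬ ArrowsDiag N a k → Σ[ f ∈ EdgeColoring N k ] (∀ c → ¬ αGE f c a)
  bad-colouring a ¬arrows with ∃-function₂? transport good?
    where
    Good : (Fin N → Fin N → Fin k) → Set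
    Good col = Σ (∀ x y → col x y ≡ col y x) λ col-sym → ∀ c → ¬ αGE (record { col = col ; sym = col-sym }) c a
    transport : ∀ {col col′} → (∀ x y → col x y ≡ col′ x y) → Good col → Good col′
    transport col≗col′ (col-sym , ¬α) =
      (λ x y → trans (sym (col≗col′ x y)) (trans (col-sym x y) (col≗col′ y x))) ,
      λ c (g , g-inj , g-indep) → ¬α c (g , g-inj , λ i j i≢j → g-indep i j i≢j ∘ trans (sym (col≗col′ (g i) (g j))))
    good? : ∀ col → Dec (Good col)
    good? col with all? (λ x → all? λ y → col x y ≟ col y x)
    ... | no  asym    = no (asym ∘ λ (col-sym , _) → col-sym)
    ... | yes col-sym = map′ (col-sym ,_) (λ (_ , ¬α) → ¬α)
                             (all? λ c → ¬? (αGE? (record { col = col ; sym = col-sym }) c a))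
  ... | yes (col , col-sym , ¬α) = record { col = col ; sym = col-sym } , ¬α
  ... | no ¬good = ⊥-elim (¬arrows arrows)
    where
    arrows : ArrowsDiag N a k
    arrows f with any? (λ c → αGE? f c a)
    ... | yes α = α
    ... | no ¬α = contradiction (EdgeColoring.col f , EdgeColoring.sym f , λ c α → ¬α (c , α)) ¬good

-- Labellings of the cells and complete sets of MOLS

JointlyInjective : ∀ {V : Set} {n} → (V → Fin n) → (V → Fin n) → Set
JointlyInjective ℓ ℓ′ = ∀ {x y} → ℓ x ≡ ℓ y → ℓ′ x ≡ ℓ′ y → x ≡ y

JointlySurjective : ∀ {V : Set} {n} → (V → Fin n) → (V → Fin n) → Set
JointlySurjective ℓ ℓ′ = ∀ i j → ∃ λ x → ℓ x ≡ i × ℓ′ x ≡ j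

JointlyInjective-sym : ∀ {V : Set} {n} {ℓ ℓ′ : V → Fin n} → JointlyInjective ℓ ℓ′ → JointlyInjective ℓ′ ℓ
JointlyInjective-sym inj agree agree′ = inj agree′ agree

module LabellingColouring {N n k : ℕ} (ℓ : Fin (suc k) → Fin N → Fin n)
                          (ℓ-injective : ∀ {c c′} → c ≢ c′ → JointlyInjective (ℓ c) (ℓ c′)) where

  Agree : Fin N → Fin N → Set
  Agree x y = ∃ λ c → ℓ c x ≡ ℓ c y

  agree? : ∀ x y → Dec (Agree x y)
  agree? x y = any? λ c → ℓ c x ≟ ℓ c y

  -- Pairs agreeing on no labelling get the arbitrary colour zero.
  colour : Fin N → Fin N → Fin (suc k)
  colour x y with agree? x y
  ... | yes (c , _) = c
  ... | no  _       = zero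

  agreement-unique : ∀ {x y c c′} → x ≢ y → ℓ c x ≡ ℓ c y → ℓ c′ x ≡ ℓ c′ y → c ≡ c′
  agreement-unique {c = c} {c′} x≢y agree agree′ with c ≟ c′
  ... | yes c≡c′ = c≡c′
  ... | no  c≢c′ = contradiction (ℓ-injective c≢c′ agree agree′) x≢y

  colour-agreeing : ∀ {x y c} → x ≢ y → ℓ c x ≡ ℓ c y → colour x y ≡ c
  colour-agreeing {x} {y} x≢y agree with agree? x y
  ... | yes (_ , agree′) = agreement-unique x≢y agree′ agree
  ... | no  disagree     = contradiction (_ , agree) disagree

  colour-disagreeing : ∀ {x y} → ¬ Agree x y → colour x y ≡ zero
  colour-disagreeing {x} {y} disagree with agree? x y
  ... | yes agree = contradiction agree disagree
  ... | no  _     = refl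

  colour-sym : ∀ x y → colour x y ≡ colour y x
  colour-sym x y with x ≟ y
  ... | yes refl = refl
  ... | no  x≢y  = by-cases (agree? x y)
    where
    by-cases : Dec (Agree x y) → colour x y ≡ colour y x
    by-cases (yes (c , agree)) =
      trans (colour-agreeing x≢y agree) (sym (colour-agreeing (x≢y ∘ sym) (sym agree)))
    by-cases (no disagree) =
      trans (colour-disagreeing disagree) (sym (colour-disagreeing λ (c , agree) → disagree (c , sym agree)))

  colouring : EdgeColoring N (suc k)
  colouring = record { col = colour ; sym = colour-sym }

  no-large-independent : ∀ c → ¬ αGE colouring c (suc n)
  no-large-independent c (g , g-injective , g-independent) with pigeonhole (n<1+n n) (ℓ c ∘ g)
  ... | i , j , i<j , agree = g-independent i j (<⇒≢ i<j) (colour-agreeing (<⇒≢ i<j ∘ g-injective) agree)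

data ParallelClass (m : ℕ) : Set where
  rows columns : ParallelClass m
  square       : Fin m → ParallelClass m

module _ {m : ℕ} where

  encode : ParallelClass m → Fin (suc m + 1)
  encode rows       = zero
  encode columns    = suc (m ↑ʳ zero)
  encode (square a) = suc (a ↑ˡ 1)

  decode : Fin (suc m + 1) → ParallelClass m
  decode zero    = rows
  decode (suc j) = [ square , (λ _ → columns) ]′ (splitAt m j)

  decode-encode : ∀ d → decode (encode d) ≡ d
  decode-encode rows       = refl
  decode-encode columns    rewrite splitAt-↑ʳ m 1 zero = refl
  decode-encode (square a) rewrite splitAt-↑ˡ m a 1 = refl

  encode-decode : ∀ c → encode (decode c) ≡ c
  encode-decode zero = refl
  encode-decode (suc j) with splitAt m j in eq
  ... | inj₁ a    = cong suc (splitAt⁻¹-↑ˡ eq)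
  ... | inj₂ zero = cong suc (splitAt⁻¹-↑ʳ eq)

  encode-injective : ∀ {d d′} → encode d ≡ encode d′ → d ≡ d′
  encode-injective {d} {d′} same = trans (sym (decode-encode d)) (trans (cong decode same) (decode-encode d′))

  decode-injective : ∀ {c c′} → decode c ≡ decode c′ → c ≡ c′
  decode-injective {c} {c′} same = trans (sym (encode-decode c)) (trans (cong encode same) (encode-decode c′))

module MOLSLabelling {m : ℕ} (L : Fin m → LatinSquare (suc m))
                     (L-orthogonal : ∀ a b → a ≢ b → Orthogonal (L a) (L b)) where

  n : ℕ
  n = suc m

  row column : Fin (n * n) → Fin n
  row    p = proj₁ (remQuot {n} n p)
  column p = proj₂ (remQuot {n} n p)

  position-injective : JointlyInjective row column
  position-injective {p} {q} same-row same-column =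
    trans (sym (combine-remQuot {n} n p)) (trans (cong₂ combine same-row same-column) (combine-remQuot {n} n q))

  label : ParallelClass m → Fin (n * n) → Fin n
  label rows       = row
  label columns    = column
  label (square a) p = cell (L a) (row p) (column p)

  rows-square : ∀ a → JointlyInjective row (label (square a))
  rows-square a {p} {q} same-row same-symbol = position-injective same-row
    (proj₁ (rowBij (L a) (row p)) (trans same-symbol (cong (λ i → cell (L a) i (column q)) (sym same-row))))

  columns-square : ∀ a → JointlyInjective column (label (square a))
  columns-square a {p} {q} same-column same-symbol = position-injective
    (proj₁ (colBij (L a) (column p)) (trans same-symbol (cong (cell (L a) (row q)) (sym same-column))))
    same-column

  square-square : ∀ {a b} → a ≢ b → JointlyInjective (label (square a)) (label (square b))
  square-square {a} {b} a≢b same-a same-b with proj₁ (L-orthogonal a b a≢b) (cong₂ _,_ same-a same-b)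
  ... | same-position = position-injective (cong proj₁ same-position) (cong proj₂ same-position)

  label-injective : ∀ {d d′} → d ≢ d′ → JointlyInjective (label d) (label d′)
  label-injective {rows}     {rows}       d≢d′ = contradiction refl d≢d′
  label-injective {rows}     {columns}    _    = position-injective
  label-injective {rows}     {square a}   _    = rows-square a
  label-injective {columns}  {rows}       _    = JointlyInjective-sym position-injective
  label-injective {columns}  {columns}    d≢d′ = contradiction refl d≢d′
  label-injective {columns}  {square a}   _    = columns-square a
  label-injective {square a} {rows}       _    = JointlyInjective-sym (rows-square a)
  label-injective {square a} {columns}    _    = JointlyInjective-sym (columns-square a)
  label-injective {square a} {square b} d≢d′   = square-square (d≢d′ ∘ cong square)

module LabellingMOLS {V : Set} {m : ℕ} (ℓ : ParallelClass m → V → Fin (suc m))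
                     (ℓ-injective  : ∀ {d d′} → d ≢ d′ → JointlyInjective (ℓ d) (ℓ d′))
                     (ℓ-surjective : ∀ {d d′} → d ≢ d′ → JointlySurjective (ℓ d) (ℓ d′)) where

  n : ℕ
  n = suc m

  point : Fin n → Fin n → V
  point i j = proj₁ (ℓ-surjective {rows} {columns} (λ ()) i j)

  point-row : ∀ i j → ℓ rows (point i j) ≡ i
  point-row i j = proj₁ (proj₂ (ℓ-surjective {rows} {columns} (λ ()) i j))

  point-column : ∀ i j → ℓ columns (point i j) ≡ j
  point-column i j = proj₂ (proj₂ (ℓ-surjective {rows} {columns} (λ ()) i j))

  point-coordinates : ∀ x → point (ℓ rows x) (ℓ columns x) ≡ x
  point-coordinates x = ℓ-injective {rows} {columns} (λ ()) (point-row _ _) (point-column _ _)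

  line-bijective : ∀ {d₁ d₂ s} (φ : Fin n → Fin n → V) → d₁ ≢ s →
                   (∀ i j → ℓ d₁ (φ i j) ≡ i) → (∀ i j → ℓ d₂ (φ i j) ≡ j) →
                   (∀ x → φ (ℓ d₁ x) (ℓ d₂ x) ≡ x) → ∀ i → Bijective _≡_ _≡_ (λ j → ℓ s (φ i j))
  line-bijective {d₁} {d₂} {s} φ d₁≢s φ₁ φ₂ φ-coordinates i = injective , surjective
    where
    injective : ∀ {j j′} → ℓ s (φ i j) ≡ ℓ s (φ i j′) → j ≡ j′
    injective {j} {j′} same-s =
      trans (sym (φ₂ i j)) (trans (cong (ℓ d₂) (ℓ-injective d₁≢s (trans (φ₁ i j) (sym (φ₁ i j′))) same-s)) (φ₂ i j′))
    surjective : ∀ y → ∃ λ j → ∀ {j′} → j′ ≡ j → ℓ s (φ i j′) ≡ y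
    surjective y with ℓ-surjective d₁≢s i y
    ... | x , refl , refl = ℓ d₂ x , λ { refl → cong (ℓ s) (φ-coordinates x) }

  latinSquare : Fin m → LatinSquare n
  latinSquare a = record
    { cell   = λ i j → ℓ (square a) (point i j)
    ; rowBij = line-bijective point (λ ()) point-row point-column point-coordinates
    ; colBij = line-bijective (flip point) (λ ()) (flip point-column) (flip point-row) point-coordinates
    }

  latinSquare-orthogonal : ∀ a b → a ≢ b → Orthogonal (latinSquare a) (latinSquare b)
  latinSquare-orthogonal a b a≢b = injective , surjective
    where
    a≢ᵖb : square a ≢ square b
    a≢ᵖb refl = a≢b refl
    injective : ∀ {p q} → (ℓ (square a) (point (proj₁ p) (proj₂ p)) , ℓ (square b) (point (proj₁ p) (proj₂ p)))
                        ≡ (ℓ (square a) (point (proj₁ q) (proj₂ q)) , ℓ (square b) (point (proj₁ q) (proj₂ q))) → p ≡ q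
    injective {i , j} {i′ , j′} same with ℓ-injective a≢ᵖb (cong proj₁ same) (cong proj₂ same)
    ... | same-point = cong₂ _,_ (trans (sym (point-row i j)) (trans (cong (ℓ rows) same-point) (point-row i′ j′)))
                                 (trans (sym (point-column i j)) (trans (cong (ℓ columns) same-point) (point-column i′ j′)))
    surjective : ∀ y → ∃ λ p → ∀ {q} → q ≡ p →
                 (ℓ (square a) (point (proj₁ q) (proj₂ q)) , ℓ (square b) (point (proj₁ q) (proj₂ q))) ≡ y
    surjective (y , y′) with ℓ-surjective a≢ᵖb y y′
    ... | x , refl , refl = (ℓ rows x , ℓ columns x) ,
                            λ { refl → cong (λ z → ℓ (square a) z , ℓ (square b) z) (point-coordinates x) }

  mols : CompleteMOLS n
  mols = latinSquare , latinSquare-orthogonal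

-- Colourings of K_{n²} in which every colour has independence number at most n

degree-arith : ∀ m d F → suc d + F ≡ suc m * suc m → F ≤ suc m * m → m ≤ d
degree-arith m d F total F≤ = +-cancelʳ-≤ (suc m * m) m d (s≤s⁻¹ (begin
  suc (m + suc m * m) ≡⟨ cong suc (solve m) ⟩
  suc m * suc m       ≡⟨ total ⟨
  suc d + F           ≤⟨ +-monoʳ-≤ (suc d) F≤ ⟩
  suc (d + suc m * m) ∎))
  where
  open ≤-Reasoning
  solve : ∀ m → m + suc m * m ≡ m + m * suc m
  solve = solve-∀

module ExtremalColouring {m : ℕ} (f : EdgeColoring (suc m * suc m) (suc m + 1))
                         (α≤n : ∀ c → ¬ αGE f c (suc (suc m))) where

  open Colouring f
  open EdgeColoring f using (col)

  n : ℕ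
  n = suc m

  V K : Set
  V = Fin (n * n)
  K = Fin (n + 1)

  independence-bound-all : ∀ c S → IndependenceBound c n S
  independence-bound-all c = independence-bound c n (α≤n c)

  ∣nonNeighbours∣≤ : ∀ c x → ∣ nonNeighbours c x ∣ ≤ n * m
  ∣nonNeighbours∣≤ c x = mixed-bound m refl c (nonNeighbours c x)
    (nonNeighbours-bound c m (independence-bound-all c _) x)
    (λ d _ → independence-bound-all d _)

  m≤degree : ∀ c x → m ≤ degree c x
  m≤degree c x = degree-arith m (degree c x) ∣ nonNeighbours c x ∣
    (trans (cong (_+ ∣ nonNeighbours c x ∣) (sym (∣closedNeighbourhood∣ c x))) (∣∣+∣∁∣ (closedNeighbourhood c x)))
    (∣nonNeighbours∣≤ c x)

  ∑-degree : ∀ x → ∑[ c < n + 1 ] degree c x ≡ (n + 1) * m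
  ∑-degree x = +-cancelʳ-≡ 1 _ _ (trans (∑-neighboursIn full x)
                                        (trans (sum-const (n * n) 1) (solve m)))
    where
    solve : ∀ m → suc m * suc m * 1 ≡ (suc m + 1) * m + 1
    solve = solve-∀

  degree≡ : ∀ c x → degree c x ≡ m
  degree≡ c x = sum-≥-tight m (λ d → m≤degree d x) (∑-degree x) c

  ∣nonNeighbours∣≡ : ∀ c x → ∣ nonNeighbours c x ∣ ≡ suc m * m
  ∣nonNeighbours∣≡ c x = +-cancelˡ-≡ n _ _ (begin
    n + ∣ nonNeighbours c x ∣                        ≡⟨ cong (_+ ∣ nonNeighbours c x ∣) (cong suc (degree≡ c x)) ⟨
    suc (degree c x) + ∣ nonNeighbours c x ∣         ≡⟨ cong (_+ ∣ nonNeighbours c x ∣) (∣closedNeighbourhood∣ c x) ⟨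
    ∣ closedNeighbourhood c x ∣ + ∣ nonNeighbours c x ∣ ≡⟨ ∣∣+∣∁∣ (closedNeighbourhood c x) ⟩
    n * n                                            ≡⟨ *-suc n m ⟩
    n + n * m                                        ∎)
    where open ≡-Reasoning

  closedNeighbourhood-closed : ∀ c {v y z} → closedNeighbourhood c v y ≡ true → colourClass c y z ≡ true →
                               closedNeighbourhood c v z ≡ true
  closedNeighbourhood-closed c {v} {y} {z} y∈N y~z with closedNeighbourhood c v z in z∈N
  ... | true  = refl
  ... | false = contradiction
      (no-edge-leaves c m (nonNeighbours c v) (degree≡ c) (∣nonNeighbours∣≡ c v)
        (nonNeighbours-bound c m (independence-bound-all c _) v) (cong not z∈N)
        (trans (colourClass-sym c z y) y~z))
      (λ y∈far → contradiction (trans (sym (cong not y∈N)) y∈far) λ ())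

  Related : K → V → V → Set
  Related c x y = x ≡ y ⊎ colourClass c x y ≡ true

  related? : ∀ c x y → Dec (Related c x y)
  related? c x y = (x ≟ y) ⊎-dec (colourClass c x y Bool.≟ true)

  related⇒∈closedNeighbourhood : ∀ c {x y} → Related c x y → closedNeighbourhood c x y ≡ true
  related⇒∈closedNeighbourhood c {x} (inj₁ refl) = insert-∈ˡ (colourClass c x) x
  related⇒∈closedNeighbourhood c {x} {y} (inj₂ x~y) = insert-∈ʳ (colourClass c x) x y x~y

  ∈closedNeighbourhood⇒related : ∀ c {x y} → closedNeighbourhood c x y ≡ true → Related c x y
  ∈closedNeighbourhood⇒related c {x} {y} y∈N with ∈-insert (colourClass c x) x y y∈N
  ... | inj₁ y≡x = inj₁ (sym y≡x)
  ... | inj₂ x~y = inj₂ x~y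

  related-sym : ∀ c {x y} → Related c x y → Related c y x
  related-sym c (inj₁ x≡y)   = inj₁ (sym x≡y)
  related-sym c {x} {y} (inj₂ x~y) = inj₂ (trans (colourClass-sym c y x) x~y)

  related-trans : ∀ c {x y z} → Related c x y → Related c y z → Related c x z
  related-trans c (inj₁ refl) y≈z = y≈z
  related-trans c x≈y (inj₂ y~z) =
    ∈closedNeighbourhood⇒related c (closedNeighbourhood-closed c (related⇒∈closedNeighbourhood c x≈y) y~z)
  related-trans c x≈y (inj₁ refl) = x≈y

  related-unique : ∀ c d {x y} → c ≢ d → Related c x y → Related d x y → x ≡ y
  related-unique _ _ _   (inj₁ x≡y) _          = x≡y
  related-unique _ _ _   (inj₂ _)   (inj₁ x≡y) = x≡y
  related-unique c d c≢d (inj₂ x~ᶜy) (inj₂ x~ᵈy) =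
    contradiction (trans (sym (proj₂ (colourClass-elim {c} x~ᶜy))) (proj₂ (colourClass-elim {d} x~ᵈy))) c≢d

  ∣closedNeighbourhood∣≡n : ∀ c x → ∣ closedNeighbourhood c x ∣ ≡ n
  ∣closedNeighbourhood∣≡n c x = trans (∣closedNeighbourhood∣ c x) (cong suc (degree≡ c x))

  -- Opaque: unfolding the size proof inside is prohibitively expensive.
  opaque
    listing : ∀ c t → Σ[ g ∈ (Fin n → V) ] Injective _≡_ _≡_ g × (∀ i → closedNeighbourhood c t (g i) ≡ true)
    listing c t = enumerate n (closedNeighbourhood c t) (≤-reflexive (sym (∣closedNeighbourhood∣≡n c t)))

  member : K → V → Fin n → V
  member c t = proj₁ (listing c t)

  member-injective : ∀ c t → Injective _≡_ _≡_ (member c t)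
  member-injective c t = proj₁ (proj₂ (listing c t))

  member-related : ∀ c t i → Related c t (member c t i)
  member-related c t i = ∈closedNeighbourhood⇒related c (proj₂ (proj₂ (listing c t)) i)

  members-related : ∀ c t i j → Related c (member c t i) (member c t j)
  members-related c t i j = related-trans c (related-sym c (member-related c t i)) (member-related c t j)

  -- Otherwise x and the d-class of t would be n + 1 vertices with no edge of colour c.
  classes-meet : ∀ {c d} → c ≢ d → ∀ t x → ∃ λ i → Related c (member d t i) x
  classes-meet {c} {d} c≢d t x with any? (λ i → related? c (member d t i) x)
  ... | yes found = found
  ... | no  none  = ⊥-elim (α≤n c (g , g-injective , g-independent))
    where
    g : Fin (suc n) → V
    g zero    = x
    g (suc i) = member d t i
    g-injective : Injective _≡_ _≡_ g
    g-injective {zero}  {zero}  _    = refl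
    g-injective {zero}  {suc j} x≡gj = contradiction (j , inj₁ (sym x≡gj)) none
    g-injective {suc i} {zero}  gi≡x = contradiction (i , inj₁ gi≡x) none
    g-injective {suc i} {suc j} same = cong suc (member-injective d t same)
    g-independent : ∀ a b → a ≢ b → col (g a) (g b) ≢ c
    g-independent a b a≢b col≡c with colourClass-intro (a≢b ∘ g-injective) col≡c
    g-independent zero    zero    a≢b _ | _     = a≢b refl
    g-independent zero    (suc j) _   _ | x~gj  = none (j , related-sym c (inj₂ x~gj))
    g-independent (suc i) zero    _   _ | gi~x  = none (i , inj₂ gi~x)
    g-independent (suc i) (suc j) a≢b _ | gi~gj =
      a≢b (g-injective (related-unique c d c≢d (inj₂ gi~gj) (members-related d t i j)))

  other : K → K
  other zero    = suc (m ↑ʳ zero)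
  other (suc _) = zero

  ≢other : ∀ c → c ≢ other c
  ≢other zero    ()
  ≢other (suc _) ()

  origin : V
  origin = zero

  -- The classes of colour c are numbered by where they meet one fixed class of another colour.
  transversal : K → Fin n → V
  transversal c = member (other c) origin

  label : K → V → Fin n
  label c x = proj₁ (classes-meet (≢other c) origin x)

  label-related : ∀ c x → Related c (transversal c (label c x)) x
  label-related c x = proj₂ (classes-meet (≢other c) origin x)

  label-unique : ∀ c {x i} → Related c (transversal c i) x → label c x ≡ i
  label-unique c {x} {i} Ti≈x = sym (member-injective (other c) origin
    (related-unique c (other c) (≢other c)
      (related-trans c Ti≈x (related-sym c (label-related c x)))
      (members-related (other c) origin i (label c x))))

  same-label⇒related : ∀ c {x y} → label c x ≡ label c y → Related c x y
  same-label⇒related c {x} {y} same = related-trans c (related-sym c (label-related c x))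
    (subst (λ i → Related c (transversal c i) y) (sym same) (label-related c y))

  label-injective : ∀ {c c′} → c ≢ c′ → JointlyInjective (label c) (label c′)
  label-injective {c} {c′} c≢c′ same same′ =
    related-unique c c′ c≢c′ (same-label⇒related c same) (same-label⇒related c′ same′)

  label-surjective : ∀ {c c′} → c ≢ c′ → JointlySurjective (label c) (label c′)
  label-surjective {c} {c′} c≢c′ i j with classes-meet (c≢c′ ∘ sym) (transversal c i) (transversal c′ j)
  ... | i′ , x≈Tj = member c (transversal c i) i′ ,
                    label-unique c (member-related c (transversal c i) i′) ,
                    label-unique c′ (related-sym c′ x≈Tj)

  mols : CompleteMOLS n
  mols = LabellingMOLS.mols (label ∘ encode) (λ d≢d′ → label-injective (d≢d′ ∘ encode-injective))
                                              (λ d≢d′ → label-surjective (d≢d′ ∘ encode-injective))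

n²+1-arrows : ∀ n → ArrowsDiag (n * n + 1) (n + 1) (n + 1)
n²+1-arrows n f with any? (λ c → αGE? f c (n + 1))
... | yes α = α
... | no ¬α = contradiction (subst (_≤ n * n) ∣full∣ all≤n²) (1+n≰n ∘ subst (_≤ n * n) (+-comm (n * n) 1))
  where
  open Colouring f
  all≤n² : ∣ full {n * n + 1} ∣ ≤ n * n
  all≤n² = uniform-bound n refl full λ c → independence-bound c n (¬α ∘ (c ,_) ∘ subst (αGE f c) (+-comm 1 n)) full

restrict : ∀ {N N′ k} → N ≤ N′ → EdgeColoring N′ k → EdgeColoring N k
restrict N≤N′ f = record
  { col = λ x y → EdgeColoring.col f (inject≤ x N≤N′) (inject≤ y N≤N′)
  ; sym = λ x y → EdgeColoring.sym f (inject≤ x N≤N′) (inject≤ y N≤N′)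
  }

restriction : ∀ {N N′ k a} → N ≤ N′ → (f : EdgeColoring N′ k) → (∀ c → ¬ αGE f c a) → ¬ ArrowsDiag N a k
restriction N≤N′ f ¬α arrows with arrows (restrict N≤N′ f)
... | c , g , g-injective , g-independent =
  ¬α c ((λ i → inject≤ (g i) N≤N′) , (g-injective ∘ inject≤-injective N≤N′ N≤N′ _ _) , g-independent)

MOLS⇒colouring : ∀ {m} → CompleteMOLS (suc m) →
                 Σ[ f ∈ EdgeColoring (suc m * suc m) (suc m + 1) ] (∀ c → ¬ αGE f c (suc m + 1))
MOLS⇒colouring {m} (L , L-orthogonal) =
  colouring , λ c → no-large-independent c ∘ subst (αGE colouring c) (+-comm (suc m) 1)
  where
  open MOLSLabelling L L-orthogonal using (label; label-injective)
  open LabellingColouring (label ∘ decode) (λ c≢c′ → label-injective (c≢c′ ∘ decode-injective))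

theorem5p5 : (n : ℕ) → 1 ≤ n →
    CompleteMOLS n ⇔ RbarDiagIs (n + 1) (n + 1) (n * n + 1)
theorem5p5 (suc m) _ = mk⇔ forward backward
  where
  n : ℕ
  n = suc m
  forward : CompleteMOLS n → RbarDiagIs (n + 1) (n + 1) (n * n + 1)
  forward mols with MOLS⇒colouring mols
  ... | f , ¬α = m≤n+m 1 (n * n) , n²+1-arrows n , λ N _ N<n²+1 →
    restriction (m<1+n⇒m≤n (subst (N <_) (+-comm (n * n) 1) N<n²+1)) f ¬α
  backward : RbarDiagIs (n + 1) (n + 1) (n * n + 1) → CompleteMOLS n
  backward (_ , _ , below-fails) with bad-colouring (n + 1) (below-fails (n * n) (s≤s z≤n) (m<m+n (n * n) (s≤s z≤n)))
  ... | f , ¬α = ExtremalColouring.mols f (λ c → ¬α c ∘ subst (αGE f c) (+-comm 1 n))
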